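{- Let $X$ be a conditional set on the complete Boolean algebra $\mathcal{A}$. Then the collection $P(X)$ of all conditional subsets of $X$, partially ordered by conditional inclusion $\sqsubseteq$, is a complete Boolean algebra with least element $\mathbf{0}$ and greatest element $X$. Moreover, for conditional subsets $Y,Y^i\sqsubseteq X$, where $Y^i$ lives on $a_i$ for each $i$: (i) the supremum (conditional union) $\sqcup Y^i$ is the conditional subset living on $\bigvee a_i$ whose primal set is the stable set $$\Big\{\sum b_i y_i : (b_i)\in p(\textstyle\bigvee a_i),\ b_i\le a_i,\ y_i\in Y^i_{b_i}\text{ for all } i\Big\}$$ if the family is non-empty, and $\mathbf{0}$ otherwise; (ii) the infimum (conditional intersection) $\sqcap Y^i$ is the conditional subset living on $a_\ast:=\bigvee\{a\le \bigwedge a_i : \bigcap_i Y^i_a\neq\emptyset\}$ whose primal set is the stable set $\bigcap_i Y^i_{a_\ast}$ if the family is non-empty, and $X$ otherwise; (iii) the complement of $Y$ is $Y^{\sqsubset}:=\sqcup\{Z\sqsubseteq X : Y\sqcap Z=\mathbf{0}\}$.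
   Context: $\mathcal{A}$ is a complete Boolean algebra with $0\neq1$; $a\le b$ means $a\wedge b=a$, and $\mathcal{A}_b=\{a\in\mathcal{A}: a\le b\}$. For $a\in\mathcal{A}$, $p(a)$ is the set of families $(a_i)$ in $\mathcal{A}$ with $\bigvee a_i=a$ and $a_i\wedge a_j=0$ for $i\ne j$ (members equal to $0$ are allowed). A conditional set on $\mathcal{A}$ is $X=(X_a,\gamma_a)_{a\in\mathcal{A}}$, with sets $X_a$ and maps $\gamma_a:X_1\to X_a$, such that: $X_0$ is a singleton; each $\gamma_a$ is surjective; $\gamma_1$ is the identity; (consistency) $a\le b$ and $\gamma_b(x)=\gamma_b(y)$ imply $\gamma_a(x)=\gamma_a(y)$; (stability) for every $(a_i)\in p(1)$ and $(x_i)\in\prod_i X_{a_i}$ there is a unique $x\in X_1$ with $\gamma_{a_i}(x)=x_i$ for all $i$. For $a\le b$, $\gamma^b_a:X_b\to X_a$ denotes the induced map with $\gamma^b_a\circ\gamma_b=\gamma_a$, and $ax:=\gamma^b_a(x)$ for $x\in X_b$. For $(a_i)\in p(a)$ and $x_i\in X_{a_i}$, $\sum a_i x_i$ denotes the unique $x\in X_a$ with $a_ix=x_i$ for all $i$. The conditional empty set $\mathbf{0}$ is the unique conditional set on the one-element algebra $\{0\}$ (conditional sets differing only in their $0$-component are identified). A conditional set $Y=(Y_a,\delta_a)_{a\in\mathcal{B}}$ is a conditional subset of $X$, written $Y\sqsubseteq X$, if there is $b\in\mathcal{A}$ (we say $Y$ lives on $b$) with $\mathcal{B}=\mathcal{A}_b$,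 $Y_a\subseteq X_a$ and $\delta_a$ equal to the restriction of $\gamma^b_a$ to $Y_b$ for all $a\le b$; $\mathbf{0}$ is the conditional subset living on $0$. A non-empty $Y\subseteq X_b$ is stable if $\sum a_i(a_iy_i)\in Y$ for all $(a_i)\in p(b)$ and $(y_i)\subseteq Y$; stable subsets of $X_b$ correspond bijectively to conditional subsets living on $b$ (via their primal set $Y_b$). -}

module Defs where

open import Level using (0ℓ)
open import Data.Product using (Σ; Σ-syntax; _×_; _,_; proj₁; proj₂)
open import Data.Bool using (Bool; true; false)
open import Relation.Nullary using (¬_)
open import Relation.Binary.PropositionalEquality using (_≡_; _≢_; refl; sym; trans; cong; subst)
open import Algebra.Core using (Op₁; Op₂)
open import Algebra.Lattice.Structures using (IsBooleanAlgebra)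
open import Relation.Binary.Definitions using (Trichotomous; Transitive)
open import Induction.WellFounded using (WellFounded)
open import Function.Bundles using (_⇔_)

-- Classical metatheory (the paper works in ZFC).  These are taken as
-- explicit hypotheses of the theorem.

WellOrderingPrinciple : Set₁
WellOrderingPrinciple =
  (I : Set) → Σ[ _<_ ∈ (I → I → Set) ]
    (Transitive _<_ × Trichotomous _≡_ _<_ × WellFounded _<_)

record CompleteBooleanAlgebra : Set₁ where
  infixr 6 _∨_
  infixr 7 _∧_
  field
    Carrier          : Set
    _∨_ _∧_          : Op₂ Carrier
    ∁_               : Op₁ Carrier
    𝟙 𝟘              : Carrier
    isBooleanAlgebra : IsBooleanAlgebra _≡_ _∨_ _∧_ ∁_ 𝟙 𝟘
    -- a ≤ b means a ∧ b ≡ a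
    ⋁        : {I : Set} → (I → Carrier) → Carrier
    ⋁-upper  : {I : Set} (f : I → Carrier) (i : I) → f i ∧ ⋁ f ≡ f i
    ⋁-least  : {I : Set} (f : I → Carrier) (c : Carrier) →
               ((i : I) → f i ∧ c ≡ f i) → ⋁ f ∧ c ≡ ⋁ f
    ⋀        : {I : Set} → (I → Carrier) → Carrier
    ⋀-lower  : {I : Set} (f : I → Carrier) (i : I) → ⋀ f ∧ f i ≡ ⋀ f
    ⋀-great  : {I : Set} (f : I → Carrier) (c : Carrier) →
               ((i : I) → c ∧ f i ≡ c) → c ∧ ⋀ f ≡ c
    nontrivial : 𝟘 ≢ 𝟙

  open IsBooleanAlgebra isBooleanAlgebra public
    using (∧-absorbs-∨; ∨-absorbs-∧)

  infix 4 _≤_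
  _≤_ : Carrier → Carrier → Set
  a ≤ b = a ∧ b ≡ a

  ≤-refl : ∀ {a} → a ≤ a
  ≤-refl {a} =
    trans (cong (a ∧_) (sym (∨-absorbs-∧ a a))) (∧-absorbs-∨ a (a ∧ a))

  IsPartition : {I : Set} → (I → Carrier) → Carrier → Set
  IsPartition {I} c a = (⋁ c ≡ a) × ((i j : I) → i ≢ j → c i ∧ c j ≡ 𝟘)

  partition≤ : {I : Set} {c : I → Carrier} {a : Carrier} →
               IsPartition c a → (i : I) → c i ≤ a
  partition≤ {c = c} (eq , _) i = subst (λ z → c i ∧ z ≡ c i) eq (⋁-upper c i)

module _ (A : CompleteBooleanAlgebra) where
  open CompleteBooleanAlgebra A

  record ConditionalSet : Set₁ where
    field
      X  : Carrier → Set
      γ  : (a : Carrier) → X 𝟙 → X a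
      X𝟘-singleton : Σ[ x₀ ∈ X 𝟘 ] ((x : X 𝟘) → x ≡ x₀)
      γ-surjective : (a : Carrier) (y : X a) → Σ[ x ∈ X 𝟙 ] (γ a x ≡ y)
      γ𝟙-id        : (x : X 𝟙) → γ 𝟙 x ≡ x
      consistency  : {a b : Carrier} → a ≤ b → (x y : X 𝟙) →
                     γ b x ≡ γ b y → γ a x ≡ γ a y
      stability    : {I : Set} (c : I → Carrier) → IsPartition c 𝟙 →
                     (xs : (i : I) → X (c i)) →
                     Σ[ x ∈ X 𝟙 ] (((i : I) → γ (c i) x ≡ xs i) ×
                       ((x' : X 𝟙) → ((i : I) → γ (c i) x' ≡ xs i) → x' ≡ x))

    -- the induced map γ^b_a : X_b → X_a  (a ≤ b), γ^b_a ∘ γ_b = γ_a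
    restr : {a b : Carrier} → a ≤ b → X b → X a
    restr {a} {b} _ y = γ a (proj₁ (γ-surjective b y))

module _ {A : CompleteBooleanAlgebra} (𝕏 : ConditionalSet A) where
  open CompleteBooleanAlgebra A
  open ConditionalSet 𝕏

  -- A conditional subset living on b: sets Y_a ⊆ X_a (a ≤ b; the
  -- components at a ≰ b are irrelevant) such that (Y_a, γ^b_a|Y_b)_{a ≤ b}
  -- is a conditional set on 𝒜_b.
  record CondSubset : Set₁ where
    field
      b  : Carrier
      Y  : (a : Carrier) → X a → Set
      Y𝟘-singleton  : Σ[ y₀ ∈ X 𝟘 ] (Y 𝟘 y₀ × ((y : X 𝟘) → Y 𝟘 y → y ≡ y₀))
      δ-into        : {a : Carrier} (p : a ≤ b) (y : X b) → Y b y → Y a (restr p y)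
      δ-surjective  : {a : Carrier} (p : a ≤ b) (y' : X a) → Y a y' →
                      Σ[ y ∈ X b ] (Y b y × restr p y ≡ y')
      δ-b-id        : (y : X b) → Y b y → restr ≤-refl y ≡ y
      δ-consistency : {a a' : Carrier} (p : a ≤ b) (p' : a' ≤ b) → a ≤ a' →
                      (y y' : X b) → Y b y → Y b y' →
                      restr p' y ≡ restr p' y' → restr p y ≡ restr p y'
      δ-stability   : {I : Set} (c : I → Carrier) (P : IsPartition c b) →
                      (ys : (i : I) → X (c i)) → ((i : I) → Y (c i) (ys i)) →
                      Σ[ y ∈ X b ] (Y b y ×
                        ((i : I) → restr (partition≤ P i) y ≡ ys i) ×
                        ((y' : X b) → Y b y' →
                          ((i : I) → restr (partition≤ P i) y' ≡ ys i) → y' ≡ y))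

  open CondSubset

  infix 4 _⊑_ _≋_
  _⊑_ : CondSubset → CondSubset → Set
  S ⊑ T = (b S ≤ b T) × ((a : Carrier) → a ≤ b S → (x : X a) → Y S a x → Y T a x)

  _≋_ : CondSubset → CondSubset → Set
  S ≋ T = (b S ≡ b T) × ((a : Carrier) → a ≤ b S → (x : X a) → Y S a x ⇔ Y T a x)

  IsWhole : CondSubset → Set
  IsWhole S = (b S ≡ 𝟙) × ((a : Carrier) (x : X a) → Y S a x)

  IsEmpty : CondSubset → Set
  IsEmpty S = b S ≡ 𝟘

  IsLUB : {I : Set} → (I → CondSubset) → CondSubset → Set₁
  IsLUB {I} F S = ((i : I) → F i ⊑ S) × ((W : CondSubset) → ((i : I) → F i ⊑ W) → S ⊑ W)

  IsGLB : {I : Set} → (I → CondSubset) → CondSubset → Set₁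
  IsGLB {I} F S = ((i : I) → S ⊑ F i) × ((W : CondSubset) → ((i : I) → W ⊑ F i) → W ⊑ S)

  IsLUBOf : (CondSubset → Set) → CondSubset → Set₁
  IsLUBOf P S = ((Z : CondSubset) → P Z → Z ⊑ S) ×
                ((W : CondSubset) → ((Z : CondSubset) → P Z → Z ⊑ W) → S ⊑ W)

  pair : CondSubset → CondSubset → Bool → CondSubset
  pair S T true  = S
  pair S T false = T

  UnionSpec : {I : Set} → (I → CondSubset) → CondSubset → Set
  UnionSpec {I} F S =
    (I → (b S ≡ ⋁ (λ i → b (F i))) ×
         ((x : X (⋁ (λ i → b (F i)))) →
            Y S (⋁ (λ i → b (F i))) x ⇔
            (Σ[ c ∈ (I → Carrier) ] Σ[ P ∈ IsPartition c (⋁ (λ i → b (F i))) ]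
               (((i : I) → c i ≤ b (F i)) ×
                Σ[ ys ∈ ((i : I) → X (c i)) ]
                  (((i : I) → Y (F i) (c i) (ys i)) ×
                   ((i : I) → restr (partition≤ P i) x ≡ ys i))))))
    × (¬ I → IsEmpty S)

  a⋆ : {I : Set} → (I → CondSubset) → Carrier
  a⋆ {I} F = ⋁ {Σ[ a ∈ Carrier ] ((a ≤ ⋀ (λ i → b (F i))) ×
                  Σ[ x ∈ X a ] ((i : I) → Y (F i) a x))} proj₁

  InterSpec : {I : Set} → (I → CondSubset) → CondSubset → Set
  InterSpec {I} F S =
    (I → (b S ≡ a⋆ F) ×
         ((x : X (a⋆ F)) → Y S (a⋆ F) x ⇔ ((i : I) → Y (F i) (a⋆ F) x)))
    × (¬ I → IsWhole S)

  record CondSubsetsFormCBA : Set₂ where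
    field
      ⊑-refl    : (S : CondSubset) → S ⊑ S
      ⊑-trans   : (S T U : CondSubset) → S ⊑ T → T ⊑ U → S ⊑ U
      ⊑-antisym : (S T : CondSubset) → S ⊑ T → T ⊑ S → S ≋ T

      ⊔ : {I : Set} → (I → CondSubset) → CondSubset
      ⊓ : {I : Set} → (I → CondSubset) → CondSubset
      ⊔-lub  : {I : Set} (F : I → CondSubset) → IsLUB F (⊔ F)
      ⊓-glb  : {I : Set} (F : I → CondSubset) → IsGLB F (⊓ F)
      ⊔-spec : {I : Set} (F : I → CondSubset) → UnionSpec F (⊔ F)
      ⊓-spec : {I : Set} (F : I → CondSubset) → InterSpec F (⊓ F)

      𝟎       : CondSubset
      𝟎-empty : IsEmpty 𝟎
      𝟎-least : (S : CondSubset) → 𝟎 ⊑ S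
      𝐗          : CondSubset
      𝐗-whole    : IsWhole 𝐗
      𝐗-greatest : (S : CondSubset) → S ⊑ 𝐗

      distrib : (S T U : CondSubset) →
                ⊓ (pair S (⊔ (pair T U))) ≋ ⊔ (pair (⊓ (pair S T)) (⊓ (pair S U)))

      _ᶜ      : CondSubset → CondSubset
      ᶜ-meet  : (S : CondSubset) → ⊓ (pair S (S ᶜ)) ≋ 𝟎
      ᶜ-join  : (S : CondSubset) → ⊔ (pair S (S ᶜ)) ≋ 𝐗
      ᶜ-spec  : (S : CondSubset) →
                IsLUBOf (λ Z → ⊓ (pair S Z) ≋ 𝟎) (S ᶜ)

-- A conditional subset is determined by its primal set, and every non-empty stable subset of
-- X_c is the primal set of a conditional subset living on c. So suprema and infima are obtained
-- by exhibiting their primal sets: the points of X_{⋁ a_i} covered, along a partition, by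
-- pieces of the Y^i, and ⋂ Y^i_{a⋆}. Both are stable; they are non-empty because a family of
-- levels can be disjointified along a well-order and the given points glued. Membership at a
-- level a below the top is established by gluing the point with a fixed point of the primal
-- set on the complementary piece. The complement of Y is the union of all singletons
-- {x} ⊆ X_a none of whose non-zero restrictions lies in Y. Distributivity follows by
-- intersecting with S a cover of a point by pieces of T and U.

module Submission where

open import Defs
open import Level using (0ℓ)
open import Axiom.ExcludedMiddle using (ExcludedMiddle)
open import Data.Product using (Σ; Σ-syntax; _×_; _,_; proj₁; proj₂)
open import Data.Bool using (Bool; true; false)
open import Data.Maybe using (Maybe; just; nothing)
open import Data.Unit using (⊤; tt)
open import Data.Empty using (⊥-elim)
open import Relation.Nullary using (¬_; yes; no)
open import Relation.Binary.PropositionalEquality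
open import Function.Bundles using (_⇔_; mk⇔; Equivalence)
open import Induction.WellFounded using (Acc; acc)
open import Relation.Binary.Definitions using (tri<; tri≈; tri>)
open import Algebra.Lattice.Structures using (IsBooleanAlgebra)
open import Algebra.Lattice.Bundles using (BooleanAlgebra)
import Algebra.Lattice.Properties.BooleanAlgebra as BooleanAlgebraProperties
import Algebra.Lattice.Properties.Lattice as LatticeProperties
import Relation.Binary.Lattice as OrderLattice
open import Function.Properties.Equivalence using () renaming (trans to ⇔-trans)

module CompleteBooleanAlgebraProperties (A : CompleteBooleanAlgebra) where
  open CompleteBooleanAlgebra A public
  open IsBooleanAlgebra isBooleanAlgebra public
    using (∧-comm; ∧-distribˡ-∨; ∧-distribʳ-∨; ∨-complementʳ; ∧-complementʳ)

  booleanAlgebra : BooleanAlgebra 0ℓ 0ℓ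
  booleanAlgebra = record { isBooleanAlgebra = isBooleanAlgebra }

  open BooleanAlgebraProperties booleanAlgebra public
    using (∧-zeroˡ; ∧-zeroʳ; ∧-identityʳ; ∨-identityʳ)

  -- The library orders a lattice by a ≡ a ∧ b, the symmetric form of _≤_.
  private
    module Ord = OrderLattice.Lattice
      (LatticeProperties.∨-∧-orderTheoreticLattice (BooleanAlgebra.lattice booleanAlgebra))

  ≤-reflexive : ∀ {a b} → a ≡ b → a ≤ b
  ≤-reflexive refl = ≤-refl

  ≤-trans : ∀ {a b c} → a ≤ b → b ≤ c → a ≤ c
  ≤-trans p q = sym (Ord.trans (sym p) (sym q))

  ≤-antisym : ∀ {a b} → a ≤ b → b ≤ a → a ≡ b
  ≤-antisym p q = Ord.antisym (sym p) (sym q)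

  ≤-respˡ : ∀ {a a′ b} → a ≡ a′ → a ≤ b → a′ ≤ b
  ≤-respˡ refl p = p

  x∧y≤x : ∀ {a b} → a ∧ b ≤ a
  x∧y≤x {a} {b} = sym (Ord.x∧y≤x a b)

  x∧y≤y : ∀ {a b} → a ∧ b ≤ b
  x∧y≤y {a} {b} = sym (Ord.x∧y≤y a b)

  ∧-greatest : ∀ {a b c} → c ≤ a → c ≤ b → c ≤ a ∧ b
  ∧-greatest p q = sym (Ord.∧-greatest (sym p) (sym q))

  ∧-mono : ∀ {a b c d} → a ≤ c → b ≤ d → a ∧ b ≤ c ∧ d
  ∧-mono p q = ∧-greatest (≤-trans x∧y≤x p) (≤-trans x∧y≤y q)

  x≤x∨y : ∀ {a b} → a ≤ a ∨ b
  x≤x∨y {a} {b} = sym (Ord.x≤x∨y a b)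

  y≤x∨y : ∀ {a b} → b ≤ a ∨ b
  y≤x∨y {a} {b} = sym (Ord.y≤x∨y a b)

  ∨-least : ∀ {a b c} → a ≤ c → b ≤ c → a ∨ b ≤ c
  ∨-least p q = sym (Ord.∨-least (sym p) (sym q))

  𝟘≤ : ∀ {a} → 𝟘 ≤ a
  𝟘≤ {a} = ∧-zeroˡ a

  ≤𝟙 : ∀ {a} → a ≤ 𝟙
  ≤𝟙 {a} = ∧-identityʳ a

  ≤𝟘⇒≡𝟘 : ∀ {a} → a ≤ 𝟘 → a ≡ 𝟘
  ≤𝟘⇒≡𝟘 {a} p = trans (sym p) (∧-zeroʳ a)

  disjoint-mono : ∀ {a b c d} → a ≤ c → b ≤ d → c ∧ d ≡ 𝟘 → a ∧ b ≡ 𝟘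
  disjoint-mono p q e = ≤𝟘⇒≡𝟘 (subst (_ ≤_) e (∧-mono p q))

  disjoint-sym : ∀ {a b} → a ∧ b ≡ 𝟘 → b ∧ a ≡ 𝟘
  disjoint-sym {a} {b} e = trans (∧-comm b a) e

  ∨-disjoint : ∀ {a b c} → a ∧ c ≡ 𝟘 → b ∧ c ≡ 𝟘 → (a ∨ b) ∧ c ≡ 𝟘
  ∨-disjoint {a} {b} {c} e f = trans (∧-distribʳ-∨ c a b) (trans (cong₂ _∨_ e f) (∨-identityʳ 𝟘))

  disjoint-∁ : ∀ {a b c} → a ≤ c → a ∧ (b ∧ ∁ c) ≡ 𝟘
  disjoint-∁ p = disjoint-mono p x∧y≤y (∧-complementʳ _)

  ∧-∁-split : ∀ a b → a ≡ (a ∧ b) ∨ (a ∧ ∁ b)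
  ∧-∁-split a b = trans (sym (∧-identityʳ a))
    (trans (cong (a ∧_) (sym (∨-complementʳ b))) (∧-distribˡ-∨ a b (∁ b)))

  ≤⇒≡∨∧∁ : ∀ {a b} → a ≤ b → b ≡ a ∨ (b ∧ ∁ a)
  ≤⇒≡∨∧∁ {a} {b} p = trans (∧-∁-split b a) (cong (_∨ (b ∧ ∁ a)) (trans (∧-comm b a) p))

  ⋁-lub : ∀ {I : Set} {f : I → Carrier} {c} → (∀ i → f i ≤ c) → ⋁ f ≤ c
  ⋁-lub {f = f} {c} = ⋁-least f c

  ⋁-mono : ∀ {I : Set} {f g : I → Carrier} → (∀ i → f i ≤ g i) → ⋁ f ≤ ⋁ g
  ⋁-mono {g = g} h = ⋁-lub (λ i → ≤-trans (h i) (⋁-upper g i))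

  ⋀-glb : ∀ {I : Set} {f : I → Carrier} {c} → (∀ i → c ≤ f i) → c ≤ ⋀ f
  ⋀-glb {f = f} {c} = ⋀-great f c

  ∧-distribˡ-⋁ : ∀ {I : Set} a (f : I → Carrier) → a ∧ ⋁ f ≡ ⋁ (λ i → a ∧ f i)
  ∧-distribˡ-⋁ a f = ≤-antisym ≤⋁ (⋁-lub (λ i → ∧-mono ≤-refl (⋁-upper f i)))
    where
    g = λ i → a ∧ f i
    -- every f i lies below ⋁ g ∨ ∁ a, and a ∧ (⋁ g ∨ ∁ a) = a ∧ ⋁ g
    f≤ : ∀ i → f i ≤ ⋁ g ∨ ∁ a
    f≤ i = ≤-respˡ (sym (∧-∁-split (f i) a))
      (∨-least (≤-trans (≤-reflexive (∧-comm (f i) a)) (≤-trans (⋁-upper g i) x≤x∨y))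
               (≤-trans x∧y≤y y≤x∨y))
    ≤⋁ : a ∧ ⋁ f ≤ ⋁ g
    ≤⋁ = ≤-trans (∧-mono ≤-refl (⋁-lub f≤))
      (≤-trans (≤-reflexive (trans (∧-distribˡ-∨ a (⋁ g) (∁ a))
                 (trans (cong ((a ∧ ⋁ g) ∨_) (∧-complementʳ a)) (∨-identityʳ _))))
               x∧y≤y)

  ⋁-𝟘 : ∀ {I : Set} {f : I → Carrier} → (∀ i → f i ≡ 𝟘) → ⋁ f ≡ 𝟘
  ⋁-𝟘 h = ≤𝟘⇒≡𝟘 (⋁-lub (λ i → ≤-respˡ (sym (h i)) 𝟘≤))

  ⋁-disjoint : ∀ {I : Set} {f : I → Carrier} {c} → (∀ i → f i ∧ c ≡ 𝟘) → ⋁ f ∧ c ≡ 𝟘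
  ⋁-disjoint {f = f} {c} h = trans (∧-comm (⋁ f) c)
    (trans (∧-distribˡ-⋁ c f) (⋁-𝟘 (λ i → disjoint-sym (h i))))

  ⟨_,_⟩ : Carrier → Carrier → Bool → Carrier
  ⟨ u , v ⟩ true  = u
  ⟨ u , v ⟩ false = v

  ⟨,⟩-partition : ∀ {u v b} → u ∧ v ≡ 𝟘 → u ∨ v ≡ b → IsPartition ⟨ u , v ⟩ b
  ⟨,⟩-partition {u} {v} e f = trans ⋁≡∨ f , disjoint
    where
    ⋁≡∨ : ⋁ ⟨ u , v ⟩ ≡ u ∨ v
    ⋁≡∨ = ≤-antisym (⋁-lub λ { true → x≤x∨y ; false → y≤x∨y })
                    (∨-least (⋁-upper ⟨ u , v ⟩ true) (⋁-upper ⟨ u , v ⟩ false))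
    disjoint : (i j : Bool) → i ≢ j → ⟨ u , v ⟩ i ∧ ⟨ u , v ⟩ j ≡ 𝟘
    disjoint true  true  ne = ⊥-elim (ne refl)
    disjoint true  false _  = e
    disjoint false true  _  = disjoint-sym e
    disjoint false false ne = ⊥-elim (ne refl)

  complement-partition : ∀ {a b} → a ≤ b → IsPartition ⟨ a , b ∧ ∁ a ⟩ b
  complement-partition p = ⟨,⟩-partition (disjoint-∁ ≤-refl) (sym (≤⇒≡∨∧∁ p))

  ⋁-partition : ∀ {I : Set} {f : I → Carrier} →
                ((i j : I) → i ≢ j → f i ∧ f j ≡ 𝟘) → IsPartition f (⋁ f)
  ⋁-partition disjoint = refl , disjoint

  ∧-partition : ∀ {I : Set} {c : I → Carrier} {a b} → a ≤ b → IsPartition c b →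
                IsPartition (λ i → a ∧ c i) a
  ∧-partition {c = c} {a} p (⋁c≡b , disjoint) =
    trans (sym (∧-distribˡ-⋁ a c)) (trans (cong (a ∧_) ⋁c≡b) p) ,
    λ i j ne → disjoint-mono x∧y≤y x∧y≤y (disjoint i j ne)

  extend : {I : Set} → (I → Carrier) → Carrier → Maybe I → Carrier
  extend c d (just i) = c i
  extend c d nothing  = d

  extend-partition : ∀ {I : Set} {c : I → Carrier} {a b} → IsPartition c a → a ≤ b →
                     IsPartition (extend c (b ∧ ∁ a)) b
  extend-partition {I} {c} {a} {b} P a≤b = ≤-antisym ⋁≤b b≤⋁ , disjoint
    where
    e = extend c (b ∧ ∁ a)
    ⋁≤b : ⋁ e ≤ b
    ⋁≤b = ⋁-lub λ { (just i) → ≤-trans (partition≤ P i) a≤b ; nothing → x∧y≤x }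
    a≤⋁ : a ≤ ⋁ e
    a≤⋁ = ≤-respˡ (proj₁ P) (⋁-lub (λ i → ⋁-upper e (just i)))
    b≤⋁ : b ≤ ⋁ e
    b≤⋁ = ≤-respˡ (sym (≤⇒≡∨∧∁ a≤b)) (∨-least a≤⋁ (⋁-upper e nothing))
    disjoint : (i j : Maybe I) → i ≢ j → e i ∧ e j ≡ 𝟘
    disjoint (just i) (just j) ne = proj₂ P i j (λ i≡j → ne (cong just i≡j))
    disjoint (just i) nothing  _  = disjoint-∁ (partition≤ P i)
    disjoint nothing  (just j) _  = disjoint-sym (disjoint-∁ (partition≤ P j))
    disjoint nothing  nothing  ne = ⊥-elim (ne refl)

  patch-partition : ∀ {I : Set} {c e : I → Carrier} {a b} →
                    IsPartition c a → a ≤ b → IsPartition e b →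
                    IsPartition (λ i → c i ∨ (e i ∧ ∁ a)) b
  patch-partition {c = c} {e} {a} {b} P a≤b Q = ≤-antisym ⋁≤b b≤⋁ , disjoint
    where
    c′ = λ i → c i ∨ (e i ∧ ∁ a)
    ⋁≤b : ⋁ c′ ≤ b
    ⋁≤b = ⋁-lub (λ i → ∨-least (≤-trans (partition≤ P i) a≤b)
                                (≤-trans x∧y≤x (partition≤ Q i)))
    rest≤⋁ : b ∧ ∁ a ≤ ⋁ c′
    rest≤⋁ = ≤-respˡ (trans (sym (∧-distribˡ-⋁ (∁ a) e))
                       (trans (cong (∁ a ∧_) (proj₁ Q)) (∧-comm (∁ a) b)))
                     (⋁-mono (λ i → ≤-trans (≤-reflexive (∧-comm (∁ a) (e i))) y≤x∨y))
    b≤⋁ : b ≤ ⋁ c′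
    b≤⋁ = ≤-respˡ (sym (≤⇒≡∨∧∁ a≤b))
                  (∨-least (≤-respˡ (proj₁ P) (⋁-mono (λ i → x≤x∨y))) rest≤⋁)
    disjoint : ∀ i j → i ≢ j → c′ i ∧ c′ j ≡ 𝟘
    disjoint i j ne = ∨-disjoint
      (disjoint-sym (∨-disjoint (proj₂ P j i (λ j≡i → ne (sym j≡i)))
                                (disjoint-sym (disjoint-∁ (partition≤ P i)))))
      (disjoint-sym (∨-disjoint (disjoint-∁ (partition≤ P j))
                                (disjoint-mono x∧y≤x x∧y≤x (proj₂ Q j i (λ j≡i → ne (sym j≡i))))))

  module _ (lem : ExcludedMiddle 0ℓ) where

    refine-partition : ∀ {I J : Set} {e : J → Carrier} {d : J → I → Carrier} {b} →
                       IsPartition e b → (∀ j → IsPartition (d j) b) →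
                       IsPartition (λ i → ⋁ (λ j → e j ∧ d j i)) b
    refine-partition {e = e} {d} {b} P Q = ≤-antisym ⋁≤b b≤⋁ , disjoint
      where
      c = λ i → ⋁ (λ j → e j ∧ d j i)
      ⋁≤b : ⋁ c ≤ b
      ⋁≤b = ⋁-lub (λ i → ⋁-lub (λ j → ≤-trans x∧y≤y (partition≤ (Q j) i)))
      e≤⋁ : ∀ j → e j ≤ ⋁ c
      e≤⋁ j = ≤-respˡ (trans (sym (∧-distribˡ-⋁ (e j) (d j)))
                        (trans (cong (e j ∧_) (proj₁ (Q j))) (partition≤ P j)))
                (⋁-lub (λ i → ≤-trans (⋁-upper (λ j → e j ∧ d j i) j) (⋁-upper c i)))
      b≤⋁ : b ≤ ⋁ c
      b≤⋁ = ≤-respˡ (proj₁ P) (⋁-lub e≤⋁)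
      disjoint : ∀ i i′ → i ≢ i′ → c i ∧ c i′ ≡ 𝟘
      disjoint i i′ ne =
        ⋁-disjoint (λ j → disjoint-sym (⋁-disjoint (λ j′ → disjoint-sym (pieces j j′))))
        where
        pieces : ∀ j j′ → (e j ∧ d j i) ∧ (e j′ ∧ d j′ i′) ≡ 𝟘
        pieces j j′ with lem {j ≡ j′}
        ... | yes refl = disjoint-mono x∧y≤y x∧y≤y (proj₂ (Q j) i i′ ne)
        ... | no  j≢j′ = disjoint-mono x∧y≤x x∧y≤x (proj₂ P j j′ j≢j′)

    indicator : {I : Set} → I → Carrier → I → Carrier
    indicator i a k with lem {k ≡ i}
    ... | yes _ = a
    ... | no  _ = 𝟘

    indicator-partition : ∀ {I : Set} (i : I) a → IsPartition (indicator i a) a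
    indicator-partition i a = ≤-antisym (⋁-lub ≤a) (≤-trans a≤ (⋁-upper (indicator i a) i)) , disjoint
      where
      ≤a : ∀ k → indicator i a k ≤ a
      ≤a k with lem {k ≡ i}
      ... | yes _ = ≤-refl
      ... | no  _ = 𝟘≤
      a≤ : a ≤ indicator i a i
      a≤ with lem {i ≡ i}
      ... | yes _  = ≤-refl
      ... | no i≢i = ⊥-elim (i≢i refl)
      disjoint : ∀ k k′ → k ≢ k′ → indicator i a k ∧ indicator i a k′ ≡ 𝟘
      disjoint k k′ ne with lem {k ≡ i} | lem {k′ ≡ i}
      ... | yes refl | yes refl = ⊥-elim (ne refl)
      ... | yes _    | no  _    = ∧-zeroʳ a
      ... | no  _    | _        = ∧-zeroˡ _

  -- With a well-order < on I, d i = t i ∧ ∁ ⋁_{j < i} t j; well-founded induction gives ⋁ d = ⋁ t.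
  disjointify : WellOrderingPrinciple → {I : Set} (t : I → Carrier) →
                Σ[ d ∈ (I → Carrier) ] ((∀ i → d i ≤ t i) × IsPartition d (⋁ t))
  disjointify wop {I} t with wop I
  ... | _<_ , _ , compare , wf =
    d , (λ i → x∧y≤x) , ≤-antisym (⋁-mono (λ i → x∧y≤x)) (⋁-lub (λ i → t≤⋁d i (wf i))) , disjoint
    where
    below : I → Carrier
    below i = ⋁ {Σ[ j ∈ I ] (j < i)} (λ p → t (proj₁ p))
    d : I → Carrier
    d i = t i ∧ ∁ (below i)
    t≤⋁d : ∀ i → Acc _<_ i → t i ≤ ⋁ d
    t≤⋁d i (acc rec) = ≤-respˡ (sym (∧-∁-split (t i) (below i)))
      (∨-least (≤-trans x∧y≤y (⋁-lub (λ p → t≤⋁d (proj₁ p) (rec (proj₂ p))))) (⋁-upper d i))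
    disjoint : (i j : I) → i ≢ j → d i ∧ d j ≡ 𝟘
    disjoint i j ne with compare i j
    ... | tri< i<j _ _ = disjoint-∁ (≤-trans x∧y≤x (⋁-upper _ (i , i<j)))
    ... | tri≈ _ i≡j _ = ⊥-elim (ne i≡j)
    ... | tri> _ _ j<i = disjoint-sym (disjoint-∁ (≤-trans x∧y≤x (⋁-upper _ (j , j<i))))

module ConditionalSetProperties {A : CompleteBooleanAlgebra} (𝕏 : ConditionalSet A) where
  open CompleteBooleanAlgebraProperties A
  open ConditionalSet 𝕏

  x₀ : X 𝟘
  x₀ = proj₁ X𝟘-singleton

  X𝟘-unique : ∀ {a} → a ≡ 𝟘 → (u v : X a) → u ≡ v
  X𝟘-unique refl u v = trans (proj₂ X𝟘-singleton u) (sym (proj₂ X𝟘-singleton v))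

  lift : (a : Carrier) → X a → X 𝟙
  lift a y = proj₁ (γ-surjective a y)

  γ-lift : ∀ a (y : X a) → γ a (lift a y) ≡ y
  γ-lift a y = proj₂ (γ-surjective a y)

  x𝟙 : X 𝟙
  x𝟙 = lift 𝟘 x₀

  -- γ^b_a with the proof of a ≤ b dropped; definitionally equal to restr.
  ρ : (a b : Carrier) → X b → X a
  ρ a b y = γ a (lift b y)

  ρ-γ : ∀ {a b} → a ≤ b → (z : X 𝟙) → ρ a b (γ b z) ≡ γ a z
  ρ-γ {a} {b} p z = consistency p (lift b (γ b z)) z (γ-lift b (γ b z))

  ρ-id : ∀ {b} (y : X b) → ρ b b y ≡ y
  ρ-id {b} = γ-lift b

  ρ-ρ : ∀ {a b c} → a ≤ b → (y : X c) → ρ a b (ρ b c y) ≡ ρ a c y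
  ρ-ρ {c = c} p y = ρ-γ p (lift c y)

  ρ-𝟙 : ∀ {a} (z : X 𝟙) → ρ a 𝟙 z ≡ γ a z
  ρ-𝟙 {a} z = cong (γ a) (trans (sym (γ𝟙-id _)) (γ-lift 𝟙 z))

  ρ-agree-mono : ∀ {a b c} → a ≤ b → {y y′ : X c} → ρ b c y ≡ ρ b c y′ → ρ a c y ≡ ρ a c y′
  ρ-agree-mono {a} {b} p {y} {y′} e = begin
    ρ a _ y            ≡⟨ ρ-ρ p y ⟨
    ρ a b (ρ b _ y)    ≡⟨ cong (ρ a b) e ⟩
    ρ a b (ρ b _ y′)   ≡⟨ ρ-ρ p y′ ⟩
    ρ a _ y′           ∎
    where open ≡-Reasoning

  -- Stability is stated only for partitions of 𝟙; a partition of a is completed by 𝟙 ∧ ∁ a.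
  glue : ∀ {I : Set} {c : I → Carrier} {a} → IsPartition c a → (xs : ∀ i → X (c i)) →
         Σ[ x ∈ X a ] (∀ i → ρ (c i) a x ≡ xs i)
  glue {I} {c} {a} P xs =
    γ a w , λ i → trans (ρ-γ (partition≤ P i) w) (proj₁ (proj₂ glued) (just i))
    where
    xs′ : (m : Maybe I) → X (extend c (𝟙 ∧ ∁ a) m)
    xs′ (just i) = xs i
    xs′ nothing  = γ _ x𝟙
    glued = stability (extend c (𝟙 ∧ ∁ a)) (extend-partition P ≤𝟙) xs′
    w = proj₁ glued

  -- Both z′ and the gluing of γ a z with z′ on 𝟙 ∧ ∁ a agree with z′ on every piece of c.
  locality : ∀ {I : Set} {c : I → Carrier} {a} → IsPartition c a → (z z′ : X 𝟙) →
             (∀ i → γ (c i) z ≡ γ (c i) z′) → γ a z ≡ γ a z′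
  locality {I} {c} {a} P z z′ h = trans (sym (proj₁ (proj₂ glued) true)) (cong (γ a) w≡z′)
    where
    zs : (t : Bool) → X (⟨ a , 𝟙 ∧ ∁ a ⟩ t)
    zs true  = γ a z
    zs false = γ _ z′
    glued = stability ⟨ a , 𝟙 ∧ ∁ a ⟩ (complement-partition ≤𝟙) zs
    w = proj₁ glued
    unique = proj₂ (proj₂ (stability (extend c (𝟙 ∧ ∁ a)) (extend-partition P ≤𝟙)
                                     (λ m → γ _ z′)))
    w-agrees : (m : Maybe I) → γ (extend c (𝟙 ∧ ∁ a) m) w ≡ γ _ z′
    w-agrees (just i) = trans (consistency (partition≤ P i) w z (proj₁ (proj₂ glued) true)) (h i)
    w-agrees nothing  = proj₁ (proj₂ glued) false
    w≡z′ : w ≡ z′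
    w≡z′ = trans (unique w w-agrees) (sym (unique z′ (λ _ → refl)))

  glue-unique : ∀ {I : Set} {c : I → Carrier} {a} → IsPartition c a → (x x′ : X a) →
                (∀ i → ρ (c i) a x ≡ ρ (c i) a x′) → x ≡ x′
  glue-unique {a = a} P x x′ h =
    trans (sym (γ-lift a x)) (trans (locality P _ _ h) (γ-lift a x′))

module CondSubsetProperties {A : CompleteBooleanAlgebra} (𝕏 : ConditionalSet A) where
  open CompleteBooleanAlgebraProperties A
  open ConditionalSet 𝕏
  open ConditionalSetProperties 𝕏

  Sub : Set₁
  Sub = CondSubset 𝕏

  open CondSubset

  Y-𝟘 : (S : Sub) (y : X 𝟘) → Y S 𝟘 y
  Y-𝟘 S y = subst (Y S 𝟘) (X𝟘-unique refl _ y) (proj₁ (proj₂ (Y𝟘-singleton S)))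

  Y-ρ : (S : Sub) {a a′ : Carrier} → a′ ≤ a → a ≤ b S → {x : X a} → Y S a x → Y S a′ (ρ a′ a x)
  Y-ρ S a′≤a a≤b Yx with δ-surjective S a≤b _ Yx
  ... | y , Yy , refl = subst (Y S _) (sym (ρ-ρ a′≤a y)) (δ-into S (≤-trans a′≤a a≤b) y Yy)

  Y-ρ-ρ : (S : Sub) {a a′ c : Carrier} → a′ ≤ a → a ≤ b S → (z : X c) →
          Y S a (ρ a c z) → Y S a′ (ρ a′ c z)
  Y-ρ-ρ S a′≤a a≤b z Yz = subst (Y S _) (ρ-ρ a′≤a z) (Y-ρ S a′≤a a≤b Yz)

  primal-nonempty : (S : Sub) → Σ[ y ∈ X (b S) ] Y S (b S) y
  primal-nonempty S with δ-surjective S 𝟘≤ _ (proj₁ (proj₂ (Y𝟘-singleton S)))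
  ... | y , Yy , _ = y , Yy

  -- δ-stability is stated only for partitions of b S; a partition of a is completed by a point of S.
  Y-glue : (S : Sub) {I : Set} {c : I → Carrier} {a : Carrier} → IsPartition c a → a ≤ b S →
           (x : X a) → (∀ i → Y S (c i) (ρ (c i) a x)) → Y S a x
  Y-glue S {I} {c} {a} P a≤b x Yx = subst (Y S a) ρy≡x (δ-into S a≤b y Yy)
    where
    y₀ = primal-nonempty S
    ys : (m : Maybe I) → X (extend c (b S ∧ ∁ a) m)
    ys (just i) = ρ (c i) a x
    ys nothing  = ρ _ (b S) (proj₁ y₀)
    Yys : ∀ m → Y S (extend c (b S ∧ ∁ a) m) (ys m)
    Yys (just i) = Yx i
    Yys nothing  = δ-into S x∧y≤x _ (proj₂ y₀)
    glued = δ-stability S (extend c (b S ∧ ∁ a)) (extend-partition P a≤b) ys Yys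
    y = proj₁ glued
    Yy = proj₁ (proj₂ glued)
    ρy≡x : ρ a (b S) y ≡ x
    ρy≡x = glue-unique P _ x
      (λ i → trans (ρ-ρ (partition≤ P i) y) (proj₁ (proj₂ (proj₂ glued)) (just i)))

  Y-glue-ρ : (S : Sub) {I : Set} {c : I → Carrier} {a d : Carrier} → IsPartition c a → a ≤ b S →
             (z : X d) → (∀ i → Y S (c i) (ρ (c i) d z)) → Y S a (ρ a d z)
  Y-glue-ρ S P a≤b z Yz =
    Y-glue S P a≤b _ (λ i → subst (Y S _) (sym (ρ-ρ (partition≤ P i) z)) (Yz i))

  infix 4 _⊑ₓ_
  _⊑ₓ_ : Sub → Sub → Set
  _⊑ₓ_ = _⊑_ 𝕏

  ⊑-fromPrimal : (S T : Sub) → b S ≤ b T → (∀ y → Y S (b S) y → Y T (b S) y) → S ⊑ₓ T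
  ⊑-fromPrimal S T bS≤bT primal = bS≤bT , λ a a≤b x Yx → below a a≤b x Yx
    where
    below : (a : Carrier) → a ≤ b S → (x : X a) → Y S a x → Y T a x
    below a a≤b x Yx with δ-surjective S a≤b x Yx
    ... | y , Yy , refl = Y-ρ T a≤b bS≤bT (primal y Yy)

  ⊑-refl : (S : Sub) → S ⊑ₓ S
  ⊑-refl S = ≤-refl , λ _ _ _ Yx → Yx

  ⊑-trans : (S T U : Sub) → S ⊑ₓ T → T ⊑ₓ U → S ⊑ₓ U
  ⊑-trans S T U (bS≤bT , S⊆T) (bT≤bU , T⊆U) =
    ≤-trans bS≤bT bT≤bU , λ a a≤b x Yx → T⊆U a (≤-trans a≤b bS≤bT) x (S⊆T a a≤b x Yx)

  ⊑-antisym : (S T : Sub) → S ⊑ₓ T → T ⊑ₓ S → _≋_ 𝕏 S T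
  ⊑-antisym S T (bS≤bT , S⊆T) (bT≤bS , T⊆S) =
    ≤-antisym bS≤bT bT≤bS , λ a a≤b x → mk⇔ (S⊆T a a≤b x) (T⊆S a (≤-trans a≤b bS≤bT) x)

  Stable : (c : Carrier) → (X c → Set) → Set₁
  Stable c P = ∀ {J : Set} (e : J → Carrier) → IsPartition e c → (x : X c) →
               (∀ j → Σ[ y ∈ X c ] (P y × ρ (e j) c y ≡ ρ (e j) c x)) → P x

  ⊤-stable : ∀ c → Stable c (λ _ → ⊤)
  ⊤-stable _ _ _ _ _ = tt

  module OfStable (c : Carrier) (P : X c → Set) (inhabited : Σ (X c) P) (stable : Stable c P) where
    -- Levels a ≰ c get no members, so membership records the bound a ≤ c.
    Member : (a : Carrier) → X a → Set
    Member a x = (a ≤ c) × Σ[ y ∈ X c ] (P y × ρ a c y ≡ x)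

    member-stability :
      {I : Set} (e : I → Carrier) (Pe : IsPartition e c) →
      (ys : (i : I) → X (e i)) → ((i : I) → Member (e i) (ys i)) →
      Σ[ y ∈ X c ] (Member c y ×
        ((i : I) → ρ (e i) c y ≡ ys i) ×
        ((y′ : X c) → Member c y′ → ((i : I) → ρ (e i) c y′ ≡ ys i) → y′ ≡ y))
    member-stability e Pe ys Mys = x , (≤-refl , x , Px , ρ-id x) , ρx≡ys , unique
      where
      glued = glue Pe ys
      x = proj₁ glued
      ρx≡ys = proj₂ glued
      Px : P x
      Px = stable e Pe x λ j → let (_ , y , Py , ρy≡ys) = Mys j in
                                y , Py , trans ρy≡ys (sym (ρx≡ys j))
      unique : (y′ : X c) → Member c y′ → (∀ i → ρ (e i) c y′ ≡ ys i) → y′ ≡ x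
      unique y′ _ h = glue-unique Pe y′ x (λ j → trans (h j) (sym (ρx≡ys j)))

    subset : Sub
    subset = record
      { b             = c
      ; Y             = Member
      ; Y𝟘-singleton  = x₀ , (𝟘≤ , proj₁ inhabited , proj₂ inhabited , X𝟘-unique refl _ _) ,
                        (λ y _ → X𝟘-unique refl y x₀)
      ; δ-into        = λ {a} a≤c _ (_ , y , Py , ρy≡) →
                          a≤c , y , Py , trans (sym (ρ-ρ a≤c y)) (cong (ρ a c) ρy≡)
      ; δ-surjective  = λ _ _ (_ , y , Py , ρy≡) → y , (≤-refl , y , Py , ρ-id y) , ρy≡
      ; δ-b-id        = λ y _ → ρ-id y
      ; δ-consistency = λ _ _ a≤a′ _ _ _ _ → ρ-agree-mono a≤a′
      ; δ-stability   = member-stability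
      }

    primal⇔ : ∀ x → Y subset c x ⇔ P x
    primal⇔ x = mk⇔ (λ (_ , y , Py , ρy≡x) → subst P (trans (sym (ρ-id y)) ρy≡x) Py)
                    (λ Px → ≤-refl , x , Px , ρ-id x)

  single : (a : Carrier) → X a → Sub
  single a x = OfStable.subset a (_≡ x) (x , refl)
    (λ e Pe x′ h → glue-unique Pe x′ x (λ j → let (y , y≡x , ρy≡) = h j in
                                               trans (sym ρy≡) (cong (ρ (e j) a) y≡x)))

  single-∈ : ∀ {a} (x : X a) → Y (single a x) a x
  single-∈ x = ≤-refl , x , refl , ρ-id x

  single-member : ∀ {a a′} {x : X a} {x′ : X a′} → Y (single a x) a′ x′ → x′ ≡ ρ a′ a x
  single-member (_ , y , y≡x , ρy≡x′) = trans (sym ρy≡x′) (cong (ρ _ _) y≡x)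

module ConditionalSubsetLattice (lem : ExcludedMiddle 0ℓ) (wop : WellOrderingPrinciple)
                                {A : CompleteBooleanAlgebra} (𝕏 : ConditionalSet A) where
  open CompleteBooleanAlgebraProperties A
  open ConditionalSet 𝕏
  open ConditionalSetProperties 𝕏
  open CondSubsetProperties 𝕏
  open CondSubset

  𝟎S : Sub
  𝟎S = OfStable.subset 𝟘 (λ _ → ⊤) (x₀ , tt) (⊤-stable 𝟘)

  𝟎-least : (S : Sub) → 𝟎S ⊑ₓ S
  𝟎-least S = ⊑-fromPrimal 𝟎S S 𝟘≤ (λ y _ → Y-𝟘 S y)

  level-𝟘⇒≋𝟎 : (S : Sub) → b S ≤ 𝟘 → _≋_ 𝕏 S 𝟎S
  level-𝟘⇒≋𝟎 S b≤𝟘 = ⊑-antisym S 𝟎S S⊑𝟎 (𝟎-least S)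
    where
    S⊑𝟎 : S ⊑ₓ 𝟎S
    S⊑𝟎 = ⊑-fromPrimal S 𝟎S b≤𝟘 (λ y _ → b≤𝟘 , x₀ , tt , X𝟘-unique (≤𝟘⇒≡𝟘 b≤𝟘) _ _)

  𝐗S : Sub
  𝐗S = OfStable.subset 𝟙 (λ _ → ⊤) (x𝟙 , tt) (⊤-stable 𝟙)

  𝐗-whole : IsWhole 𝕏 𝐗S
  𝐗-whole = refl , λ a x → ≤𝟙 , lift a x , tt , trans (ρ-𝟙 (lift a x)) (γ-lift a x)

  𝐗-greatest : (S : Sub) → S ⊑ₓ 𝐗S
  𝐗-greatest S = ≤𝟙 , λ a _ x _ → proj₂ 𝐗-whole a x

  module Union {I : Set} (F : I → Sub) where
    B : Carrier
    B = ⋁ (λ i → b (F i))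

    Cover : (a : Carrier) → X a → Set
    Cover a x = Σ[ c ∈ (I → Carrier) ] (IsPartition c a × (∀ i → c i ≤ b (F i)) ×
                                         (∀ i → Y (F i) (c i) (ρ (c i) a x)))

    cover-nonempty : Σ (X B) (Cover B)
    cover-nonempty with disjointify wop (λ i → b (F i))
    ... | d , d≤ , Pd = x , d , Pd , d≤ , Yd
      where
      y = λ i → primal-nonempty (F i)
      glued = glue Pd (λ i → ρ (d i) (b (F i)) (proj₁ (y i)))
      x = proj₁ glued
      Yd : ∀ i → Y (F i) (d i) (ρ (d i) B x)
      Yd i = subst (Y (F i) (d i)) (sym (proj₂ glued i)) (δ-into (F i) (d≤ i) _ (proj₂ (y i)))

    cover-stable : Stable B (Cover B)
    cover-stable e Pe x agree = c , refine-partition lem Pe (λ j → proj₁ (proj₂ (cov j))) , c≤ , Yc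
      where
      z = λ j → proj₁ (agree j)
      cov = λ j → proj₁ (proj₂ (agree j))
      d = λ j → proj₁ (cov j)
      d≤ = λ j → proj₁ (proj₂ (proj₂ (cov j)))
      c : I → Carrier
      c i = ⋁ (λ j → e j ∧ d j i)
      c≤ : ∀ i → c i ≤ b (F i)
      c≤ i = ⋁-lub (λ j → ≤-trans x∧y≤y (d≤ j i))
      Yc : ∀ i → Y (F i) (c i) (ρ (c i) B x)
      Yc i = Y-glue-ρ (F i)
        (⋁-partition (λ j j′ ne → disjoint-mono x∧y≤x x∧y≤x (proj₂ Pe j j′ ne))) (c≤ i) x piece
        where
        piece : ∀ j → Y (F i) (e j ∧ d j i) (ρ (e j ∧ d j i) B x)
        piece j = subst (Y (F i) _) (ρ-agree-mono x∧y≤x (proj₂ (proj₂ (agree j))))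
                        (Y-ρ-ρ (F i) x∧y≤y (d≤ j i) (z j) (proj₂ (proj₂ (proj₂ (cov j))) i))

    union : Sub
    union = OfStable.subset B (Cover B) cover-nonempty cover-stable

    -- x is glued with a covered point w outside a, patching the cover of x with that of w.
    union-intro : ∀ {a} {x : X a} → Cover a x → Y union a x
    union-intro {a} {x} (c , Pc , c≤ , Yc) =
      a≤B , z , (c′ , patch-partition Pc a≤B Pe , c′≤ , Yc′) , ρz≡ true
      where
      a≤B : a ≤ B
      a≤B = ≤-respˡ (proj₁ Pc) (⋁-mono c≤)
      w = proj₁ cover-nonempty
      e = proj₁ (proj₂ cover-nonempty)
      Pe = proj₁ (proj₂ (proj₂ cover-nonempty))
      e≤ = proj₁ (proj₂ (proj₂ (proj₂ cover-nonempty)))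
      Ye = proj₂ (proj₂ (proj₂ (proj₂ cover-nonempty)))
      xs : (t : Bool) → X (⟨ a , B ∧ ∁ a ⟩ t)
      xs true  = x
      xs false = ρ (B ∧ ∁ a) B w
      glued = glue (complement-partition a≤B) xs
      z = proj₁ glued
      ρz≡ = proj₂ glued
      c′ : I → Carrier
      c′ i = c i ∨ (e i ∧ ∁ a)
      c′≤ : ∀ i → c′ i ≤ b (F i)
      c′≤ i = ∨-least (c≤ i) (≤-trans x∧y≤x (e≤ i))
      Yc′ : ∀ i → Y (F i) (c′ i) (ρ (c′ i) B z)
      Yc′ i = Y-glue-ρ (F i) (⟨,⟩-partition (disjoint-∁ (partition≤ Pc i)) refl) (c′≤ i) z piece
        where
        piece : ∀ t → Y (F i) (⟨ c i , e i ∧ ∁ a ⟩ t) (ρ (⟨ c i , e i ∧ ∁ a ⟩ t) B z)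
        piece true  = subst (Y (F i) (c i))
                        (trans (sym (cong (ρ (c i) a) (ρz≡ true))) (ρ-ρ (partition≤ Pc i) z)) (Yc i)
        piece false = subst (Y (F i) _)
                        (ρ-agree-mono (∧-mono (partition≤ Pe i) ≤-refl) (sym (ρz≡ false)))
                        (Y-ρ-ρ (F i) x∧y≤x (e≤ i) w (Ye i))

    union-elim : ∀ {a} {x : X a} → Y union a x → Cover a x
    union-elim {a} {x} (a≤B , z , (d , Pd , d≤ , Yd) , ρz≡x) =
      (λ i → a ∧ d i) , ∧-partition a≤B Pd , (λ i → ≤-trans x∧y≤y (d≤ i)) , Yc
      where
      Yc : ∀ i → Y (F i) (a ∧ d i) (ρ (a ∧ d i) a x)
      Yc i = subst (Y (F i) _) (trans (sym (ρ-ρ x∧y≤x z)) (cong (ρ _ a) ρz≡x))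
                   (Y-ρ-ρ (F i) x∧y≤y (d≤ i) z (Yd i))

    union-upper : ∀ i → F i ⊑ₓ union
    union-upper i = ⊑-fromPrimal (F i) union (⋁-upper _ i) λ y Yy →
      union-intro (indicator lem i (b (F i)) , indicator-partition lem i (b (F i)) , δ≤ , Yδ y Yy)
      where
      δ≤ : ∀ k → indicator lem i (b (F i)) k ≤ b (F k)
      δ≤ k with lem {k ≡ i}
      ... | yes refl = ≤-refl
      ... | no  _    = 𝟘≤
      Yδ : ∀ y → Y (F i) (b (F i)) y → ∀ k →
           Y (F k) (indicator lem i (b (F i)) k) (ρ (indicator lem i (b (F i)) k) (b (F i)) y)
      Yδ y Yy k with lem {k ≡ i}
      ... | yes refl = subst (Y (F k) (b (F k))) (sym (ρ-id y)) Yy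
      ... | no  _    = Y-𝟘 (F k) _

    union-least : (W : Sub) → (∀ i → F i ⊑ₓ W) → union ⊑ₓ W
    union-least W F⊑W = ⊑-fromPrimal union W B≤ λ z Yz →
      let (c , P , c≤ , Yc) = union-elim Yz in
      Y-glue W P B≤ z (λ i → proj₂ (F⊑W i) (c i) (c≤ i) _ (Yc i))
      where
      B≤ : B ≤ b W
      B≤ = ⋁-lub (λ i → proj₁ (F⊑W i))

    union-spec : UnionSpec 𝕏 F union
    union-spec = (λ _ → refl , λ x → ⇔-trans (primal⇔ x) (mk⇔
                   (λ (c , P , c≤ , Yc) → c , P , c≤ , _ , Yc , (λ _ → refl))
                   (λ (c , P , c≤ , ys , Yys , ρx≡ys) →
                      c , P , c≤ , λ i → subst (Y (F i) (c i)) (sym (ρx≡ys i)) (Yys i)))) ,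
                 (λ ¬I → ≤𝟘⇒≡𝟘 (⋁-lub (λ i → ⊥-elim (¬I i))))
      where open OfStable B (Cover B) cover-nonempty cover-stable using (primal⇔)

  module Intersection {I : Set} (F : I → Sub) where
    M : Carrier
    M = ⋀ (λ i → b (F i))

    Witness : Set
    Witness = Σ[ a ∈ Carrier ] ((a ≤ M) × Σ[ x ∈ X a ] ((i : I) → Y (F i) a x))

    a⋆-upper : ∀ {a} → a ≤ M → (x : X a) → (∀ i → Y (F i) a x) → a ≤ a⋆ 𝕏 F
    a⋆-upper a≤M x Yx = ⋁-upper {Witness} proj₁ (_ , a≤M , x , Yx)

    a⋆-least : ∀ {c} → (∀ {a} → a ≤ M → (x : X a) → (∀ i → Y (F i) a x) → a ≤ c) →
               a⋆ 𝕏 F ≤ c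
    a⋆-least h = ⋁-lub {Witness} (λ (_ , a≤M , x , Yx) → h a≤M x Yx)

    a⋆≤ : ∀ i → a⋆ 𝕏 F ≤ b (F i)
    a⋆≤ i = ≤-trans (a⋆-least (λ a≤M _ _ → a≤M)) (⋀-lower _ i)

    InAll : X (a⋆ 𝕏 F) → Set
    InAll x = ∀ i → Y (F i) (a⋆ 𝕏 F) x

    -- The witnesses of a⋆ are disjointified and glued.
    inAll-nonempty : Σ (X (a⋆ 𝕏 F)) InAll
    inAll-nonempty with disjointify wop {Witness} proj₁
    ... | d , d≤ , Pd = x , λ i → Y-glue (F i) Pd (a⋆≤ i) x λ (τ@(_ , a≤M , _ , Yτ)) →
            subst (Y (F i) (d τ)) (sym (ρx≡ τ))
                  (Y-ρ (F i) (d≤ τ) (≤-trans a≤M (⋀-lower _ i)) (Yτ i))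
      where
      glued = glue Pd (λ (τ@(a , _ , xτ , _)) → ρ (d τ) a xτ)
      x = proj₁ glued
      ρx≡ = proj₂ glued

    inAll-stable : Stable (a⋆ 𝕏 F) InAll
    inAll-stable e Pe x agree i = Y-glue (F i) Pe (a⋆≤ i) x λ j →
      let (y , Yy , ρy≡ρx) = agree j in
      subst (Y (F i) (e j)) ρy≡ρx (Y-ρ (F i) (partition≤ Pe j) (a⋆≤ i) (Yy i))

    intersection : Sub
    intersection = OfStable.subset (a⋆ 𝕏 F) InAll inAll-nonempty inAll-stable

    open OfStable (a⋆ 𝕏 F) InAll inAll-nonempty inAll-stable using (primal⇔)

    -- x is glued with a point of the intersection outside a.
    intersection-intro : ∀ {a} → a ≤ M → (x : X a) → (∀ i → Y (F i) a x) → Y intersection a x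
    intersection-intro {a} a≤M x Yx = a≤a⋆ , z , Yz , ρz≡ true
      where
      a≤a⋆ = a⋆-upper a≤M x Yx
      w = inAll-nonempty
      xs : (t : Bool) → X (⟨ a , a⋆ 𝕏 F ∧ ∁ a ⟩ t)
      xs true  = x
      xs false = ρ _ (a⋆ 𝕏 F) (proj₁ w)
      glued = glue (complement-partition a≤a⋆) xs
      z = proj₁ glued
      ρz≡ = proj₂ glued
      Yz : InAll z
      Yz i = Y-glue (F i) (complement-partition a≤a⋆) (a⋆≤ i) z λ where
        true  → subst (Y (F i) a) (sym (ρz≡ true)) (Yx i)
        false → subst (Y (F i) _) (sym (ρz≡ false)) (Y-ρ (F i) x∧y≤x (a⋆≤ i) (proj₂ w i))

    intersection-lower : ∀ i → intersection ⊑ₓ F i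
    intersection-lower i = ⊑-fromPrimal intersection (F i) (a⋆≤ i)
      (λ y Yy → Equivalence.to (primal⇔ y) Yy i)

    intersection-elim : ∀ {a} {x : X a} → Y intersection a x → ∀ i → Y (F i) a x
    intersection-elim Yx i = proj₂ (intersection-lower i) _ (proj₁ Yx) _ Yx

    intersection-greatest : (W : Sub) → (∀ i → W ⊑ₓ F i) → W ⊑ₓ intersection
    intersection-greatest W W⊑F =
      ⊑-fromPrimal W intersection (proj₁ (inW _ (proj₂ (primal-nonempty W)))) inW
      where
      inW : ∀ y → Y W (b W) y → Y intersection (b W) y
      inW y Yy = intersection-intro (⋀-glb (λ i → proj₁ (W⊑F i))) y
                                    (λ i → proj₂ (W⊑F i) _ ≤-refl y Yy)

    intersection-spec : InterSpec 𝕏 F intersection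
    intersection-spec = (λ _ → refl , primal⇔) , whole
      where
      whole : ¬ I → IsWhole 𝕏 intersection
      whole ¬I = ≤-antisym ≤𝟙 𝟙≤a⋆ , λ a x →
          ≤-trans ≤𝟙 𝟙≤a⋆ , γ _ (lift a x) , (λ i → ⊥-elim (¬I i)) ,
          trans (ρ-γ (≤-trans ≤𝟙 𝟙≤a⋆) (lift a x)) (γ-lift a x)
        where
        𝟙≤a⋆ : 𝟙 ≤ a⋆ 𝕏 F
        𝟙≤a⋆ = a⋆-upper (⋀-glb (λ i → ⊥-elim (¬I i))) x𝟙 (λ i → ⊥-elim (¬I i))

  ⊔ : {I : Set} → (I → Sub) → Sub
  ⊔ = Union.union

  ⊓ : {I : Set} → (I → Sub) → Sub
  ⊓ = Intersection.intersection

  infixr 6 _∪_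
  infixr 7 _∩_

  _∪_ : Sub → Sub → Sub
  S ∪ T = ⊔ (pair 𝕏 S T)

  _∩_ : Sub → Sub → Sub
  S ∩ T = ⊓ (pair 𝕏 S T)

  ∩-intro : (S T : Sub) {a : Carrier} → a ≤ b S → a ≤ b T → (x : X a) →
            Y S a x → Y T a x → Y (S ∩ T) a x
  ∩-intro S T a≤S a≤T x YSx YTx = Intersection.intersection-intro (pair 𝕏 S T)
    (⋀-glb λ { true → a≤S ; false → a≤T }) x λ { true → YSx ; false → YTx }

  ∩-level-upper : (S T : Sub) {a : Carrier} → a ≤ b S → a ≤ b T → (x : X a) →
                  Y S a x → Y T a x → a ≤ b (S ∩ T)
  ∩-level-upper S T a≤S a≤T x YSx YTx = Intersection.a⋆-upper (pair 𝕏 S T)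
    (⋀-glb λ { true → a≤S ; false → a≤T }) x λ { true → YSx ; false → YTx }

  ∩-level-least : (S T : Sub) {c : Carrier} →
                  (∀ {a} → a ≤ b S → a ≤ b T → (x : X a) → Y S a x → Y T a x → a ≤ c) →
                  b (S ∩ T) ≤ c
  ∩-level-least S T h = Intersection.a⋆-least (pair 𝕏 S T) λ a≤M x Yx →
    h (≤-trans a≤M (⋀-lower _ true)) (≤-trans a≤M (⋀-lower _ false)) x (Yx true) (Yx false)

  ∩-cover : (S T U : Sub) {a : Carrier} {x : X a} → a ≤ b S → Y S a x →
            Union.Cover (pair 𝕏 T U) a x → Union.Cover (pair 𝕏 (S ∩ T) (S ∩ U)) a x
  ∩-cover S T U a≤S YSx (c , P , c≤ , Yc) = c , P , c≤′ , Yc′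
    where
    c≤S : ∀ t → c t ≤ b S
    c≤S t = ≤-trans (partition≤ P t) a≤S
    YSc : ∀ t → Y S (c t) (ρ (c t) _ _)
    YSc t = Y-ρ S (partition≤ P t) a≤S YSx
    c≤′ : ∀ t → c t ≤ b (pair 𝕏 (S ∩ T) (S ∩ U) t)
    c≤′ true  = ∩-level-upper S T (c≤S true) (c≤ true) _ (YSc true) (Yc true)
    c≤′ false = ∩-level-upper S U (c≤S false) (c≤ false) _ (YSc false) (Yc false)
    Yc′ : ∀ t → Y (pair 𝕏 (S ∩ T) (S ∩ U) t) (c t) (ρ (c t) _ _)
    Yc′ true  = ∩-intro S T (c≤S true) (c≤ true) _ (YSc true) (Yc true)
    Yc′ false = ∩-intro S U (c≤S false) (c≤ false) _ (YSc false) (Yc false)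

  ∩-distrib-∪ : (S T U : Sub) → _≋_ 𝕏 (S ∩ (T ∪ U)) ((S ∩ T) ∪ (S ∩ U))
  ∩-distrib-∪ S T U = ⊑-antisym LHS RHS LHS⊑RHS RHS⊑LHS
    where
    LHS RHS : Sub
    LHS = S ∩ (T ∪ U)
    RHS = (S ∩ T) ∪ (S ∩ U)
    open Intersection (pair 𝕏 S (T ∪ U)) using (intersection-elim; a⋆≤)
    inRHS : ∀ x → Y LHS (b LHS) x → Y RHS (b LHS) x
    inRHS x Yx = Union.union-intro (pair 𝕏 (S ∩ T) (S ∩ U))
      (∩-cover S T U (a⋆≤ true) (intersection-elim Yx true)
               (Union.union-elim (pair 𝕏 T U) (intersection-elim Yx false)))
    LHS⊑RHS : LHS ⊑ₓ RHS
    LHS⊑RHS = ⊑-fromPrimal LHS RHS (proj₁ (inRHS _ (proj₂ (primal-nonempty LHS)))) inRHS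
    ∩⊑ : ∀ V → V ⊑ₓ T ∪ U → S ∩ V ⊑ₓ LHS
    ∩⊑ V V⊑ = Intersection.intersection-greatest (pair 𝕏 S (T ∪ U)) (S ∩ V) λ where
      true  → Intersection.intersection-lower (pair 𝕏 S V) true
      false → ⊑-trans (S ∩ V) V (T ∪ U) (Intersection.intersection-lower (pair 𝕏 S V) false) V⊑
    RHS⊑LHS : RHS ⊑ₓ LHS
    RHS⊑LHS = Union.union-least (pair 𝕏 (S ∩ T) (S ∩ U)) LHS λ where
      true  → ∩⊑ T (Union.union-upper (pair 𝕏 T U) true)
      false → ∩⊑ U (Union.union-upper (pair 𝕏 T U) false)

  OutsidePoint : Sub → Set
  OutsidePoint S = Σ[ a ∈ Carrier ] Σ[ x ∈ X a ]
    (∀ {a′} → a′ ≤ a → a′ ≤ b S → Y S a′ (ρ a′ a x) → a′ ≡ 𝟘)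

  outside-single : (S : Sub) → OutsidePoint S → Sub
  outside-single S (a , x , _) = single a x

  -- The paper takes ⊔ {Z : S ⊓ Z = 𝟎}, a family indexed by a large type; the singletons
  -- of outside points form a small index type with the same supremum (complement-spec).
  _ᶜ : Sub → Sub
  S ᶜ = ⊔ (outside-single S)

  outside⇒∩≋𝟎 : (S : Sub) (k : OutsidePoint S) → _≋_ 𝕏 (S ∩ outside-single S k) 𝟎S
  outside⇒∩≋𝟎 S (a , x , outside) = level-𝟘⇒≋𝟎 (S ∩ single a x) (∩-level-least S (single a x)
    λ a′≤S a′≤a x′ YSx′ Ysingle →
      ≤-reflexive (outside a′≤a a′≤S (subst (Y S _) (single-member Ysingle) YSx′)))

  ∩≋𝟎⇒outside : (S Z : Sub) → _≋_ 𝕏 (S ∩ Z) 𝟎S → ∀ y → Y Z (b Z) y → OutsidePoint S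
  ∩≋𝟎⇒outside S Z S∩Z≋𝟎 y Yy = b Z , y , λ a′≤Z a′≤S YS →
    ≤𝟘⇒≡𝟘 (subst (_ ≤_) (proj₁ S∩Z≋𝟎)
                  (∩-level-upper S Z a′≤S a′≤Z _ YS (δ-into Z a′≤Z y Yy)))

  -- Each piece of a cover of x by outside points is 𝟘 as soon as x lies in S.
  complement-disjoint : (S : Sub) → _≋_ 𝕏 (S ∩ S ᶜ) 𝟎S
  complement-disjoint S = level-𝟘⇒≋𝟎 (S ∩ S ᶜ) (∩-level-least S (S ᶜ) a≤𝟘)
    where
    a≤𝟘 : ∀ {a} → a ≤ b S → a ≤ b (S ᶜ) → (x : X a) → Y S a x → Y (S ᶜ) a x → a ≤ 𝟘
    a≤𝟘 {a} a≤S _ x YSx YSᶜx = ≤-reflexive (trans (sym (proj₁ P)) (⋁-𝟘 piece≡𝟘))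
      where
      cover = Union.union-elim (outside-single S) YSᶜx
      c = proj₁ cover
      P = proj₁ (proj₂ cover)
      piece≡𝟘 : ∀ k → c k ≡ 𝟘
      piece≡𝟘 k@(_ , _ , outside) =
        outside (proj₁ (proj₂ (proj₂ cover)) k) (≤-trans (partition≤ P k) a≤S)
                (subst (Y S (c k)) (single-member (proj₂ (proj₂ (proj₂ cover)) k))
                       (Y-ρ S (partition≤ P k) a≤S YSx))

  -- On e = b (S ∩ {y}) the point y lies in S; on the rest 𝟙 ∧ ∁ e it is an outside point of S.
  complement-covers : (S : Sub) → _≋_ 𝕏 (S ∪ S ᶜ) 𝐗S
  complement-covers S = ⊑-antisym (S ∪ S ᶜ) 𝐗S (𝐗-greatest (S ∪ S ᶜ))
    (⊑-fromPrimal 𝐗S (S ∪ S ᶜ) (proj₁ (inUnion x𝟙)) (λ y _ → inUnion y))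
    where
    inUnion : ∀ y → Y (S ∪ S ᶜ) 𝟙 y
    inUnion y = Union.union-intro (pair 𝕏 S (S ᶜ))
      (⟨ e , e′ ⟩ , complement-partition ≤𝟙 , ≤S∪Sᶜ , Y⟨e,e′⟩)
      where
      open Intersection (pair 𝕏 S (single 𝟙 y)) using (a⋆≤; inAll-nonempty)
      e = b (S ∩ single 𝟙 y)
      e′ = 𝟙 ∧ ∁ e
      outside : ∀ {a′} → a′ ≤ e′ → a′ ≤ b S → Y S a′ (ρ a′ e′ (ρ e′ 𝟙 y)) → a′ ≡ 𝟘
      outside a′≤e′ a′≤S YS = ≤𝟘⇒≡𝟘 (subst (_ ≤_) (disjoint-∁ ≤-refl) (∧-greatest a′≤e a′≤e′))
        where
        a′≤e = ∩-level-upper S (single 𝟙 y) a′≤S ≤𝟙 _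
                 (subst (Y S _) (ρ-ρ a′≤e′ y) YS) (δ-into (single 𝟙 y) ≤𝟙 y (single-∈ y))
      y∈Sᶜ : Y (S ᶜ) e′ (ρ e′ 𝟙 y)
      y∈Sᶜ = proj₂ (Union.union-upper (outside-single S) (e′ , ρ e′ 𝟙 y , outside))
                   e′ ≤-refl _ (single-∈ _)
      ≤S∪Sᶜ : ∀ t → ⟨ e , e′ ⟩ t ≤ b (pair 𝕏 S (S ᶜ) t)
      ≤S∪Sᶜ true  = a⋆≤ true
      ≤S∪Sᶜ false = proj₁ y∈Sᶜ
      Y⟨e,e′⟩ : ∀ t → Y (pair 𝕏 S (S ᶜ) t) (⟨ e , e′ ⟩ t) (ρ (⟨ e , e′ ⟩ t) 𝟙 y)
      Y⟨e,e′⟩ true  = subst (Y S e) (single-member (proj₂ inAll-nonempty false))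
                            (proj₂ inAll-nonempty true)
      Y⟨e,e′⟩ false = y∈Sᶜ

  complement-spec : (S : Sub) → IsLUBOf 𝕏 (λ Z → _≋_ 𝕏 (S ∩ Z) 𝟎S) (S ᶜ)
  complement-spec S = upper , least
    where
    upper : (Z : Sub) → _≋_ 𝕏 (S ∩ Z) 𝟎S → Z ⊑ₓ S ᶜ
    upper Z S∩Z≋𝟎 = ⊑-fromPrimal Z (S ᶜ) (proj₁ (single⊑ _ (proj₂ (primal-nonempty Z))))
                      (λ y Yy → proj₂ (single⊑ y Yy) _ ≤-refl y (single-∈ y))
      where
      single⊑ : ∀ y → Y Z (b Z) y → single (b Z) y ⊑ₓ S ᶜ
      single⊑ y Yy = Union.union-upper (outside-single S) (∩≋𝟎⇒outside S Z S∩Z≋𝟎 y Yy)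
    least : (W : Sub) → ((Z : Sub) → _≋_ 𝕏 (S ∩ Z) 𝟎S → Z ⊑ₓ W) → S ᶜ ⊑ₓ W
    least W below = Union.union-least (outside-single S) W
      (λ k → below (outside-single S k) (outside⇒∩≋𝟎 S k))

  condSubsetsFormCBA : CondSubsetsFormCBA 𝕏
  condSubsetsFormCBA = record
    { ⊑-refl = ⊑-refl ; ⊑-trans = ⊑-trans ; ⊑-antisym = ⊑-antisym
    ; ⊔ = ⊔ ; ⊓ = ⊓
    ; ⊔-lub = λ F → Union.union-upper F , Union.union-least F
    ; ⊓-glb = λ F → Intersection.intersection-lower F , Intersection.intersection-greatest F
    ; ⊔-spec = Union.union-spec ; ⊓-spec = Intersection.intersection-spec
    ; 𝟎 = 𝟎S ; 𝟎-empty = refl ; 𝟎-least = 𝟎-least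
    ; 𝐗 = 𝐗S ; 𝐗-whole = 𝐗-whole ; 𝐗-greatest = 𝐗-greatest
    ; distrib = ∩-distrib-∪
    ; _ᶜ = _ᶜ ; ᶜ-meet = complement-disjoint ; ᶜ-join = complement-covers ; ᶜ-spec = complement-spec
    }

theorem2p8 : ExcludedMiddle 0ℓ → WellOrderingPrinciple →
    (A : CompleteBooleanAlgebra) (X : ConditionalSet A) → CondSubsetsFormCBA X
theorem2p8 lem wop A X = ConditionalSubsetLattice.condSubsetsFormCBA lem wop X
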